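{- For every $\Sigma_1(\Box)$ formula $\varphi$, $\mathsf{PA}(\mathsf{K4}) \vdash \varphi \to \Box\varphi$.
   Context: The language $\mathcal{L}_A(\Box)$ is the language of arithmetic $\{0,S,+,\times,\le,=\}$ plus a unary modal operator $\Box$. All theories use the rules modus ponens, generalization, and necessitation (from $\varphi$ infer $\Box\varphi$). $\mathsf{PA}_\Box$ is Peano arithmetic plus the first-order logical axioms for $\mathcal{L}_A(\Box)$-formulas (including universal instantiation for $\mathcal{L}_A$-terms) plus induction for all $\mathcal{L}_A(\Box)$-formulas. $\mathsf{PA}(\mathsf{K})$ is $\mathsf{PA}_\Box$ plus the universal closures of all $\Box(\varphi\to\psi)\to(\Box\varphi\to\Box\psi)$, and $\mathsf{PA}(\mathsf{K4})$ is $\mathsf{PA}(\mathsf{K})$ plus the universal closures of all $\Box\varphi\to\Box\Box\varphi$ ($\varphi,\psi$ arbitrary $\mathcal{L}_A(\Box)$-formulas). The class $\Sigma_1(\Box)$ is the smallest class of $\mathcal{L}_A(\Box)$-formulas containing all $\Sigma_1$ arithmetic formulas and all formulas of the form $\Box\varphi$, and closed under $\land$, $\lor$, $\exists x$, and $\forall x<t$ for $\mathcal{L}_A$-terms $t$ not containing $x$. -}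

module Defs where

open import Data.Nat using (ℕ; zero; suc)
open import Data.Fin using (Fin; zero; suc)

infix  6 _≐_ _≼_
infixr 5 _∧'_
infixr 4 _∨'_
infixr 3 _⇒_ _⇔_
infixl 7 _`+_
infixl 8 _`×_

data Tm (n : ℕ) : Set where
  var  : Fin n → Tm n
  `0   : Tm n
  `S   : Tm n → Tm n
  _`+_ : Tm n → Tm n → Tm n
  _`×_ : Tm n → Tm n → Tm n

data Fm (n : ℕ) : Set where
  _≐_  : Tm n → Tm n → Fm n
  _≼_  : Tm n → Tm n → Fm n
  ⊥'   : Fm n
  _⇒_  : Fm n → Fm n → Fm n
  _∧'_ : Fm n → Fm n → Fm n
  _∨'_ : Fm n → Fm n → Fm n
  ∀'   : Fm (suc n) → Fm n
  ∃'   : Fm (suc n) → Fm n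
  □    : Fm n → Fm n

¬' : ∀ {n} → Fm n → Fm n
¬' φ = φ ⇒ ⊥'

_⇔_ : ∀ {n} → Fm n → Fm n → Fm n
φ ⇔ ψ = (φ ⇒ ψ) ∧' (ψ ⇒ φ)

_≺_ : ∀ {n} → Tm n → Tm n → Fm n
s ≺ t = `S s ≼ t

renTm : ∀ {n m} → (Fin n → Fin m) → Tm n → Tm m
renTm ρ (var i)  = var (ρ i)
renTm ρ `0       = `0
renTm ρ (`S t)   = `S (renTm ρ t)
renTm ρ (s `+ t) = renTm ρ s `+ renTm ρ t
renTm ρ (s `× t) = renTm ρ s `× renTm ρ t

liftRen : ∀ {n m} → (Fin n → Fin m) → Fin (suc n) → Fin (suc m)
liftRen ρ zero    = zero
liftRen ρ (suc i) = suc (ρ i)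

ren : ∀ {n m} → (Fin n → Fin m) → Fm n → Fm m
ren ρ (s ≐ t)  = renTm ρ s ≐ renTm ρ t
ren ρ (s ≼ t)  = renTm ρ s ≼ renTm ρ t
ren ρ ⊥'       = ⊥'
ren ρ (φ ⇒ ψ)  = ren ρ φ ⇒ ren ρ ψ
ren ρ (φ ∧' ψ) = ren ρ φ ∧' ren ρ ψ
ren ρ (φ ∨' ψ) = ren ρ φ ∨' ren ρ ψ
ren ρ (∀' φ)   = ∀' (ren (liftRen ρ) φ)
ren ρ (∃' φ)   = ∃' (ren (liftRen ρ) φ)
ren ρ (□ φ)    = □ (ren ρ φ)

wkTm : ∀ {n} → Tm n → Tm (suc n)
wkTm = renTm suc

wk : ∀ {n} → Fm n → Fm (suc n)
wk = ren suc

subTm : ∀ {n m} → (Fin n → Tm m) → Tm n → Tm m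
subTm σ (var i)  = σ i
subTm σ `0       = `0
subTm σ (`S t)   = `S (subTm σ t)
subTm σ (s `+ t) = subTm σ s `+ subTm σ t
subTm σ (s `× t) = subTm σ s `× subTm σ t

liftSub : ∀ {n m} → (Fin n → Tm m) → Fin (suc n) → Tm (suc m)
liftSub σ zero    = var zero
liftSub σ (suc i) = wkTm (σ i)

sub : ∀ {n m} → (Fin n → Tm m) → Fm n → Fm m
sub σ (s ≐ t)  = subTm σ s ≐ subTm σ t
sub σ (s ≼ t)  = subTm σ s ≼ subTm σ t
sub σ ⊥'       = ⊥'
sub σ (φ ⇒ ψ)  = sub σ φ ⇒ sub σ ψ
sub σ (φ ∧' ψ) = sub σ φ ∧' sub σ ψ
sub σ (φ ∨' ψ) = sub σ φ ∨' sub σ ψ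
sub σ (∀' φ)   = ∀' (sub (liftSub σ) φ)
sub σ (∃' φ)   = ∃' (sub (liftSub σ) φ)
sub σ (□ φ)    = □ (sub σ φ)

inst : ∀ {n} → Tm n → Fin (suc n) → Tm n
inst t zero    = t
inst t (suc i) = var i

_[_] : ∀ {n} → Fm (suc n) → Tm n → Fm n
φ [ t ] = sub (inst t) φ

succVar : ∀ {n} → Fin (suc n) → Tm (suc n)
succVar zero    = `S (var zero)
succVar (suc i) = var (suc i)

-- Bounded quantifiers  ∀x<t φ  and  ∃x<t φ  (t does not contain x:
-- t lives in the outer context and is weakened).

∀<' : ∀ {n} → Tm n → Fm (suc n) → Fm n
∀<' t φ = ∀' ((var zero ≺ wkTm t) ⇒ φ)

∃<' : ∀ {n} → Tm n → Fm (suc n) → Fm n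
∃<' t φ = ∃' ((var zero ≺ wkTm t) ∧' φ)

data Δ₀ : ∀ {n} → Fm n → Set where
  eq   : ∀ {n} (s t : Tm n) → Δ₀ (s ≐ t)
  le   : ∀ {n} (s t : Tm n) → Δ₀ (s ≼ t)
  bot  : ∀ {n} → Δ₀ {n} ⊥'
  imp  : ∀ {n} {φ ψ : Fm n} → Δ₀ φ → Δ₀ ψ → Δ₀ (φ ⇒ ψ)
  and  : ∀ {n} {φ ψ : Fm n} → Δ₀ φ → Δ₀ ψ → Δ₀ (φ ∧' ψ)
  or   : ∀ {n} {φ ψ : Fm n} → Δ₀ φ → Δ₀ ψ → Δ₀ (φ ∨' ψ)
  ball : ∀ {n} (t : Tm n) {φ : Fm (suc n)} → Δ₀ φ → Δ₀ (∀<' t φ)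
  bex  : ∀ {n} (t : Tm n) {φ : Fm (suc n)} → Δ₀ φ → Δ₀ (∃<' t φ)

data Σ₁ : ∀ {n} → Fm n → Set where
  δ  : ∀ {n} {φ : Fm n} → Δ₀ φ → Σ₁ φ
  ex : ∀ {n} {φ : Fm (suc n)} → Σ₁ φ → Σ₁ (∃' φ)

data Σ₁□ : ∀ {n} → Fm n → Set where
  sigma : ∀ {n} {φ : Fm n} → Σ₁ φ → Σ₁□ φ
  box   : ∀ {n} (φ : Fm n) → Σ₁□ (□ φ)
  and   : ∀ {n} {φ ψ : Fm n} → Σ₁□ φ → Σ₁□ ψ → Σ₁□ (φ ∧' ψ)
  or    : ∀ {n} {φ ψ : Fm n} → Σ₁□ φ → Σ₁□ ψ → Σ₁□ (φ ∨' ψ)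
  ex    : ∀ {n} {φ : Fm (suc n)} → Σ₁□ φ → Σ₁□ (∃' φ)
  ball  : ∀ {n} (t : Tm n) {φ : Fm (suc n)} → Σ₁□ φ → Σ₁□ (∀<' t φ)

data LogAx : ∀ {n} → Fm n → Set where
  ax-k    : ∀ {n} (φ ψ : Fm n) → LogAx (φ ⇒ ψ ⇒ φ)
  ax-s    : ∀ {n} (φ ψ χ : Fm n) →
            LogAx ((φ ⇒ ψ ⇒ χ) ⇒ (φ ⇒ ψ) ⇒ φ ⇒ χ)
  ax-dne  : ∀ {n} (φ : Fm n) → LogAx (¬' (¬' φ) ⇒ φ)
  ax-∧e₁  : ∀ {n} (φ ψ : Fm n) → LogAx (φ ∧' ψ ⇒ φ)
  ax-∧e₂  : ∀ {n} (φ ψ : Fm n) → LogAx (φ ∧' ψ ⇒ ψ)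
  ax-∧i   : ∀ {n} (φ ψ : Fm n) → LogAx (φ ⇒ ψ ⇒ φ ∧' ψ)
  ax-∨i₁  : ∀ {n} (φ ψ : Fm n) → LogAx (φ ⇒ φ ∨' ψ)
  ax-∨i₂  : ∀ {n} (φ ψ : Fm n) → LogAx (ψ ⇒ φ ∨' ψ)
  ax-∨e   : ∀ {n} (φ ψ χ : Fm n) →
            LogAx ((φ ⇒ χ) ⇒ (ψ ⇒ χ) ⇒ φ ∨' ψ ⇒ χ)
  ax-∀e   : ∀ {n} (φ : Fm (suc n)) (t : Tm n) → LogAx (∀' φ ⇒ φ [ t ])
  ax-∀dist : ∀ {n} (φ ψ : Fm (suc n)) → LogAx (∀' (φ ⇒ ψ) ⇒ ∀' φ ⇒ ∀' ψ)
  ax-∀vac : ∀ {n} (φ : Fm n) → LogAx (φ ⇒ ∀' (wk φ))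
  ax-∃i   : ∀ {n} (φ : Fm (suc n)) (t : Tm n) → LogAx (φ [ t ] ⇒ ∃' φ)
  ax-∃e   : ∀ {n} (φ : Fm (suc n)) (ψ : Fm n) →
            LogAx (∀' (φ ⇒ wk ψ) ⇒ ∃' φ ⇒ ψ)
  ax-refl : ∀ {n} (t : Tm n) → LogAx (t ≐ t)
  ax-leib : ∀ {n} (φ : Fm (suc n)) (s t : Tm n) →
            LogAx (s ≐ t ⇒ φ [ s ] ⇒ φ [ t ])

-- Stated schematically over terms, which is
-- equivalent (via instantiation and generalization) to their closures.
data PAAx : ∀ {n} → Fm n → Set where
  q1  : ∀ {n} (s : Tm n) → PAAx (¬' (`S s ≐ `0))
  q2  : ∀ {n} (s t : Tm n) → PAAx (`S s ≐ `S t ⇒ s ≐ t)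
  q3  : ∀ {n} (s : Tm n) → PAAx (s `+ `0 ≐ s)
  q4  : ∀ {n} (s t : Tm n) → PAAx (s `+ `S t ≐ `S (s `+ t))
  q5  : ∀ {n} (s : Tm n) → PAAx (s `× `0 ≐ `0)
  q6  : ∀ {n} (s t : Tm n) → PAAx (s `× `S t ≐ s `× t `+ s)
  q7  : ∀ {n} (s t : Tm n) →
        PAAx (s ≼ t ⇔ ∃' (wkTm s `+ var zero ≐ wkTm t))
  ind : ∀ {n} (φ : Fm (suc n)) →
        PAAx (φ [ `0 ] ⇒ ∀' (φ ⇒ sub succVar φ) ⇒ ∀' φ)

data KAx : ∀ {n} → Fm n → Set where
  k : ∀ {n} (φ ψ : Fm n) → KAx (□ (φ ⇒ ψ) ⇒ □ φ ⇒ □ ψ)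

data FourAx : ∀ {n} → Fm n → Set where
  four : ∀ {n} (φ : Fm n) → FourAx (□ φ ⇒ □ (□ φ))

data PAK4⊢_ : ∀ {n} → Fm n → Set where
  log  : ∀ {n} {φ : Fm n} → LogAx φ → PAK4⊢ φ
  pa   : ∀ {n} {φ : Fm n} → PAAx φ → PAK4⊢ φ
  axK  : ∀ {n} {φ : Fm n} → KAx φ → PAK4⊢ φ
  ax4  : ∀ {n} {φ : Fm n} → FourAx φ → PAK4⊢ φ
  mp   : ∀ {n} {φ ψ : Fm n} → PAK4⊢ (φ ⇒ ψ) → PAK4⊢ φ → PAK4⊢ ψ
  gen  : ∀ {n} {φ : Fm (suc n)} → PAK4⊢ φ → PAK4⊢ ∀' φ
  nec  : ∀ {n} {φ : Fm n} → PAK4⊢ φ → PAK4⊢ □ φ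

{-# OPTIONS --safe #-}
-- Call φ complete if PA(K4) ⊢ φ → □φ, and decided if both φ and ¬φ are
-- complete.  Formulas □ψ are complete by axiom 4, and completeness is preserved
-- by ∧, ∨ and ∃ because □ is monotone (K + necessitation).  For a bounded
-- quantifier ∀x<t ψ one proves ∀y (∀x<y ψ → □ ∀x<y ψ) by induction on y, using
-- ∀x<Sy ψ ↔ ∀x<y ψ ∧ ψ(y).  That leaves the Σ₁ formulas, ∃-prefixes of Δ₀
-- formulas; Δ₀ formulas are decided, by induction on their build-up, starting
-- from atoms, where induction on x proves ∀y (x = y ∨ □ x ≠ y) and
-- ∀y (x ≤ y ∨ □ x ≰ y).
module Submission where

open import Data.Nat using (ℕ; zero; suc)
open import Data.Fin using (Fin; zero; suc)
open import Data.Product using (_×_; _,_; proj₁)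
open import Function using (_∘_)
open import Relation.Binary.PropositionalEquality
  using (_≡_; refl; sym; trans; cong; cong₂; subst; _≗_)
open import Defs

private
  variable
    n m l : ℕ

v₀ : Tm (suc n)
v₀ = var zero

v₁ : Tm (suc (suc n))
v₁ = var (suc zero)

v₂ : Tm (suc (suc (suc n)))
v₂ = var (suc (suc zero))

v₃ : Tm (suc (suc (suc (suc n))))
v₃ = var (suc (suc (suc zero)))

wk₁ : Fm (suc n) → Fm (suc (suc n))
wk₁ = ren (liftRen suc)

liftSub-liftRen : {σ : Fin m → Tm l} {ρ : Fin n → Fin m} {τ : Fin n → Tm l} →
                  σ ∘ ρ ≗ τ → liftSub σ ∘ liftRen ρ ≗ liftSub τ
liftSub-liftRen e zero    = refl
liftSub-liftRen e (suc i) = cong wkTm (e i)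

subTm-renTm : {σ : Fin m → Tm l} {ρ : Fin n → Fin m} {τ : Fin n → Tm l} →
              σ ∘ ρ ≗ τ → ∀ t → subTm σ (renTm ρ t) ≡ subTm τ t
subTm-renTm e (var i)  = e i
subTm-renTm e `0       = refl
subTm-renTm e (`S t)   = cong `S (subTm-renTm e t)
subTm-renTm e (s `+ t) = cong₂ _`+_ (subTm-renTm e s) (subTm-renTm e t)
subTm-renTm e (s `× t) = cong₂ _`×_ (subTm-renTm e s) (subTm-renTm e t)

sub-ren : {σ : Fin m → Tm l} {ρ : Fin n → Fin m} {τ : Fin n → Tm l} →
          σ ∘ ρ ≗ τ → ∀ φ → sub σ (ren ρ φ) ≡ sub τ φ
sub-ren e (s ≐ t)  = cong₂ _≐_ (subTm-renTm e s) (subTm-renTm e t)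
sub-ren e (s ≼ t)  = cong₂ _≼_ (subTm-renTm e s) (subTm-renTm e t)
sub-ren e ⊥'       = refl
sub-ren e (φ ⇒ ψ)  = cong₂ _⇒_ (sub-ren e φ) (sub-ren e ψ)
sub-ren e (φ ∧' ψ) = cong₂ _∧'_ (sub-ren e φ) (sub-ren e ψ)
sub-ren e (φ ∨' ψ) = cong₂ _∨'_ (sub-ren e φ) (sub-ren e ψ)
sub-ren e (∀' φ)   = cong ∀' (sub-ren (liftSub-liftRen e) φ)
sub-ren e (∃' φ)   = cong ∃' (sub-ren (liftSub-liftRen e) φ)
sub-ren e (□ φ)    = cong □ (sub-ren e φ)

liftSub-var : {σ : Fin n → Tm m} {ρ : Fin n → Fin m} →
              σ ≗ var ∘ ρ → liftSub σ ≗ var ∘ liftRen ρ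
liftSub-var e zero    = refl
liftSub-var e (suc i) = cong wkTm (e i)

subTm-var : {σ : Fin n → Tm m} {ρ : Fin n → Fin m} →
            σ ≗ var ∘ ρ → ∀ t → subTm σ t ≡ renTm ρ t
subTm-var e (var i)  = e i
subTm-var e `0       = refl
subTm-var e (`S t)   = cong `S (subTm-var e t)
subTm-var e (s `+ t) = cong₂ _`+_ (subTm-var e s) (subTm-var e t)
subTm-var e (s `× t) = cong₂ _`×_ (subTm-var e s) (subTm-var e t)

sub-var : {σ : Fin n → Tm m} {ρ : Fin n → Fin m} →
          σ ≗ var ∘ ρ → ∀ φ → sub σ φ ≡ ren ρ φ
sub-var e (s ≐ t)  = cong₂ _≐_ (subTm-var e s) (subTm-var e t)
sub-var e (s ≼ t)  = cong₂ _≼_ (subTm-var e s) (subTm-var e t)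
sub-var e ⊥'       = refl
sub-var e (φ ⇒ ψ)  = cong₂ _⇒_ (sub-var e φ) (sub-var e ψ)
sub-var e (φ ∧' ψ) = cong₂ _∧'_ (sub-var e φ) (sub-var e ψ)
sub-var e (φ ∨' ψ) = cong₂ _∨'_ (sub-var e φ) (sub-var e ψ)
sub-var e (∀' φ)   = cong ∀' (sub-var (liftSub-var e) φ)
sub-var e (∃' φ)   = cong ∃' (sub-var (liftSub-var e) φ)
sub-var e (□ φ)    = cong □ (sub-var e φ)

liftSub-id : {σ : Fin n → Tm n} → σ ≗ var → liftSub σ ≗ var
liftSub-id e zero    = refl
liftSub-id e (suc i) = cong wkTm (e i)

subTm-id : {σ : Fin n → Tm n} → σ ≗ var → ∀ t → subTm σ t ≡ t
subTm-id e (var i)  = e i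
subTm-id e `0       = refl
subTm-id e (`S t)   = cong `S (subTm-id e t)
subTm-id e (s `+ t) = cong₂ _`+_ (subTm-id e s) (subTm-id e t)
subTm-id e (s `× t) = cong₂ _`×_ (subTm-id e s) (subTm-id e t)

sub-id : {σ : Fin n → Tm n} → σ ≗ var → ∀ φ → sub σ φ ≡ φ
sub-id e (s ≐ t)  = cong₂ _≐_ (subTm-id e s) (subTm-id e t)
sub-id e (s ≼ t)  = cong₂ _≼_ (subTm-id e s) (subTm-id e t)
sub-id e ⊥'       = refl
sub-id e (φ ⇒ ψ)  = cong₂ _⇒_ (sub-id e φ) (sub-id e ψ)
sub-id e (φ ∧' ψ) = cong₂ _∧'_ (sub-id e φ) (sub-id e ψ)
sub-id e (φ ∨' ψ) = cong₂ _∨'_ (sub-id e φ) (sub-id e ψ)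
sub-id e (∀' φ)   = cong ∀' (sub-id (liftSub-id e) φ)
sub-id e (∃' φ)   = cong ∃' (sub-id (liftSub-id e) φ)
sub-id e (□ φ)    = cong □ (sub-id e φ)

sub-ren-var : {σ : Fin m → Tm l} {ρ : Fin n → Fin m} {ρ′ : Fin n → Fin l} →
              σ ∘ ρ ≗ var ∘ ρ′ → ∀ φ → sub σ (ren ρ φ) ≡ ren ρ′ φ
sub-ren-var e φ = trans (sub-ren e φ) (sub-var (λ _ → refl) φ)

sub-ren-id : {σ : Fin m → Tm n} {ρ : Fin n → Fin m} → σ ∘ ρ ≗ var → ∀ φ → sub σ (ren ρ φ) ≡ φ
sub-ren-id e φ = trans (sub-ren e φ) (sub-id (λ _ → refl) φ)

wkTm-[] : (s t : Tm n) → subTm (inst t) (wkTm s) ≡ s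
wkTm-[] s t = trans (subTm-renTm (λ _ → refl) s) (subTm-id (λ _ → refl) s)

wk₁-[v₀] : (φ : Fm (suc n)) → wk₁ φ [ v₀ ] ≡ φ
wk₁-[v₀] = sub-ren-id e
  where
  e : inst v₀ ∘ liftRen suc ≗ var
  e zero    = refl
  e (suc i) = refl

-- A context is one formula, extended on the right by ∧'; #0 is the last hypothesis.
infix 2 _⊩_
_⊩_ : Fm n → Fm n → Set
Γ ⊩ φ = PAK4⊢ (Γ ⇒ φ)

private
  variable
    Γ A B C φ ψ χ : Fm n
    s t u : Tm n

⇒-trans : PAK4⊢ (A ⇒ B) → PAK4⊢ (B ⇒ C) → PAK4⊢ (A ⇒ C)
⇒-trans {A = A} {B} {C} p q = mp (mp (log (ax-s A B C)) (mp (log (ax-k (B ⇒ C) A)) q)) p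

⇒-refl : PAK4⊢ (φ ⇒ φ)
⇒-refl {φ = φ} = mp (mp (log (ax-s φ (φ ⇒ φ) φ)) (log (ax-k φ (φ ⇒ φ)))) (log (ax-k φ φ))

⊢⇒⊩ : PAK4⊢ φ → Γ ⊩ φ
⊢⇒⊩ p = mp (log (ax-k _ _)) p

app : Γ ⊩ (φ ⇒ ψ) → Γ ⊩ φ → Γ ⊩ ψ
app f x = mp (mp (log (ax-s _ _ _)) f) x

app⊢ : PAK4⊢ (A ⇒ B) → Γ ⊩ A → Γ ⊩ B
app⊢ p x = app (⊢⇒⊩ p) x

app⊢₂ : PAK4⊢ (A ⇒ B ⇒ C) → Γ ⊩ A → Γ ⊩ B → Γ ⊩ C
app⊢₂ p x y = app (app⊢ p x) y

lam : (Γ ∧' φ) ⊩ ψ → Γ ⊩ (φ ⇒ ψ)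
lam {Γ = Γ} {φ} {ψ} p = app⊢₂ compose (⊢⇒⊩ p) (app⊢ (log (ax-∧i Γ φ)) ⇒-refl)
  where
  compose : PAK4⊢ (((Γ ∧' φ) ⇒ ψ) ⇒ (φ ⇒ Γ ∧' φ) ⇒ φ ⇒ ψ)
  compose = ⇒-trans (log (ax-k _ φ)) (log (ax-s φ (Γ ∧' φ) ψ))

weaken : Γ ⊩ φ → (Γ ∧' ψ) ⊩ φ
weaken p = ⇒-trans (log (ax-∧e₁ _ _)) p

#0 : (Γ ∧' φ) ⊩ φ
#0 = log (ax-∧e₂ _ _)

#1 : ((Γ ∧' φ) ∧' ψ) ⊩ φ
#1 = weaken #0

#2 : (((Γ ∧' φ) ∧' ψ) ∧' χ) ⊩ φ
#2 = weaken #1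

⊤' : Fm n
⊤' = ⊥' ⇒ ⊥'

closed : ⊤' ⊩ φ → PAK4⊢ φ
closed p = mp p ⇒-refl

∧-intro : Γ ⊩ A → Γ ⊩ B → Γ ⊩ (A ∧' B)
∧-intro = app⊢₂ (log (ax-∧i _ _))

∧-elim₁ : Γ ⊩ (A ∧' B) → Γ ⊩ A
∧-elim₁ = app⊢ (log (ax-∧e₁ _ _))

∧-elim₂ : Γ ⊩ (A ∧' B) → Γ ⊩ B
∧-elim₂ = app⊢ (log (ax-∧e₂ _ _))

∨-intro₁ : Γ ⊩ A → Γ ⊩ (A ∨' B)
∨-intro₁ = app⊢ (log (ax-∨i₁ _ _))

∨-intro₂ : Γ ⊩ B → Γ ⊩ (A ∨' B)
∨-intro₂ = app⊢ (log (ax-∨i₂ _ _))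

∨-elim : Γ ⊩ (A ∨' B) → (Γ ∧' A) ⊩ C → (Γ ∧' B) ⊩ C → Γ ⊩ C
∨-elim r p q = app (app⊢₂ (log (ax-∨e _ _ _)) (lam p) (lam q)) r

⊥'-elim : Γ ⊩ ⊥' → Γ ⊩ φ
⊥'-elim {φ = φ} p = app⊢ (log (ax-dne φ)) (app⊢ (log (ax-k ⊥' (¬' φ))) p)

by-contradiction : (Γ ∧' ¬' φ) ⊩ ⊥' → Γ ⊩ φ
by-contradiction p = app⊢ (log (ax-dne _)) (lam p)

excluded-middle : Γ ⊩ (φ ∨' ¬' φ)
excluded-middle = by-contradiction (app #0 (∨-intro₂ (lam (app #1 (∨-intro₁ #0)))))

cases : (Γ ∧' φ) ⊩ C → (Γ ∧' ¬' φ) ⊩ C → Γ ⊩ C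
cases = ∨-elim excluded-middle

cast : φ ≡ ψ → Γ ⊩ φ → Γ ⊩ ψ
cast {Γ = Γ} = subst (Γ ⊩_)

∀-intro : wk Γ ⊩ φ → Γ ⊩ ∀' φ
∀-intro {Γ = Γ} {φ = φ} p = ⇒-trans (log (ax-∀vac Γ)) (mp (log (ax-∀dist (wk Γ) φ)) (gen p))

∀-elim : (t : Tm n) → Γ ⊩ ∀' φ → Γ ⊩ φ [ t ]
∀-elim t = app⊢ (log (ax-∀e _ t))

∀-elim-wk₁ : (φ : Fm (suc n)) → Γ ⊩ ∀' (wk₁ φ) → Γ ⊩ φ
∀-elim-wk₁ φ p = cast (wk₁-[v₀] φ) (∀-elim v₀ p)

∃-intro : (t : Tm n) → Γ ⊩ φ [ t ] → Γ ⊩ ∃' φ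
∃-intro t = app⊢ (log (ax-∃i _ t))

∃-intro-wk₁ : Γ ⊩ φ → Γ ⊩ ∃' (wk₁ φ)
∃-intro-wk₁ {φ = φ} p = ∃-intro v₀ (cast (sym (wk₁-[v₀] φ)) p)

∃-elim : Γ ⊩ ∃' φ → (wk Γ ∧' φ) ⊩ wk ψ → Γ ⊩ ψ
∃-elim {φ = φ} {ψ = ψ} p q = app (app⊢ (log (ax-∃e φ ψ)) (∀-intro (lam q))) p

□-intro : PAK4⊢ φ → Γ ⊩ □ φ
□-intro p = ⊢⇒⊩ (nec p)

□-map : PAK4⊢ (A ⇒ B) → Γ ⊩ □ A → Γ ⊩ □ B
□-map p = app⊢ (mp (axK (k _ _)) (nec p))

□-map₂ : PAK4⊢ (A ⇒ B ⇒ C) → Γ ⊩ □ A → Γ ⊩ □ B → Γ ⊩ □ C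
□-map₂ p x y = app (app⊢ (axK (k _ _)) (□-map p x)) y

≐-refl : Γ ⊩ (t ≐ t)
≐-refl = ⊢⇒⊩ (log (ax-refl _))

≐-subst : (φ : Fm (suc n)) → Γ ⊩ (s ≐ t) → Γ ⊩ φ [ s ] → Γ ⊩ φ [ t ]
≐-subst {s = s} {t = t} φ = app⊢₂ (log (ax-leib φ s t))

≐-sym : Γ ⊩ (s ≐ t) → Γ ⊩ (t ≐ s)
≐-sym {s = s} {t = t} p =
  cast (cong (t ≐_) (wkTm-[] s t))
    (≐-subst (v₀ ≐ wkTm s) p (cast (cong (s ≐_) (sym (wkTm-[] s s))) ≐-refl))

≐-trans : Γ ⊩ (s ≐ t) → Γ ⊩ (t ≐ u) → Γ ⊩ (s ≐ u)
≐-trans {s = s} {t = t} {u = u} p q =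
  cast (cong (_≐ u) (wkTm-[] s u))
    (≐-subst (wkTm s ≐ v₀) q (cast (cong (_≐ t) (sym (wkTm-[] s t))) p))

≐-cong : (f : Tm (suc n)) → Γ ⊩ (s ≐ t) → Γ ⊩ (subTm (inst s) f ≐ subTm (inst t) f)
≐-cong {s = s} {t = t} f p =
  cast (cong (_≐ subTm (inst t) f) (wkTm-[] fs t))
    (≐-subst (wkTm fs ≐ f) p (cast (cong (_≐ fs) (sym (wkTm-[] fs s))) ≐-refl))
  where
  fs = subTm (inst s) f

S-cong : Γ ⊩ (s ≐ t) → Γ ⊩ (`S s ≐ `S t)
S-cong = ≐-cong (`S v₀)

+-congˡ : (a : Tm n) → Γ ⊩ (s ≐ t) → Γ ⊩ (a `+ s ≐ a `+ t)
+-congˡ {s = s} {t = t} a p =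
  cast (cong₂ (λ x y → x `+ s ≐ y `+ t) (wkTm-[] a s) (wkTm-[] a t)) (≐-cong (wkTm a `+ v₀) p)

≐-□ : Γ ⊩ (s ≐ t) → Γ ⊩ □ (s ≐ t)
≐-□ {s = s} {t = t} p =
  cast (cong (λ x → □ (x ≐ t)) (wkTm-[] s t))
    (≐-subst (□ (wkTm s ≐ v₀)) p
      (cast (cong (λ x → □ (x ≐ s)) (sym (wkTm-[] s s))) (□-intro (log (ax-refl s)))))

S≢0 : Γ ⊩ (`S s ≐ `0) → Γ ⊩ φ
S≢0 p = ⊥'-elim (app (⊢⇒⊩ (pa (q1 _))) p)

S-injective : Γ ⊩ (`S s ≐ `S t) → Γ ⊩ (s ≐ t)
S-injective = app⊢ (pa (q2 _ _))

+-identityʳ : Γ ⊩ (s `+ `0 ≐ s)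
+-identityʳ = ⊢⇒⊩ (pa (q3 _))

+-sucʳ : Γ ⊩ (s `+ `S t ≐ `S (s `+ t))
+-sucʳ = ⊢⇒⊩ (pa (q4 _ _))

induction : (φ : Fm (suc n)) → Γ ⊩ φ [ `0 ] → (wk Γ ∧' φ) ⊩ sub succVar φ → Γ ⊩ ∀' φ
induction φ base step = app⊢₂ (pa (ind φ)) base (∀-intro (lam step))

zero-or-suc : (t : Tm n) → Γ ⊩ (t ≐ `0 ∨' ∃' (wkTm t ≐ `S v₀))
zero-or-suc t = ∀-elim t (⊢⇒⊩ (closed (induction (v₀ ≐ `0 ∨' ∃' (v₁ ≐ `S v₀))
                                                   (∨-intro₁ ≐-refl) (∨-intro₂ (∃-intro v₀ ≐-refl)))))

+-identityˡ : Γ ⊩ (`0 `+ t ≐ t)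
+-identityˡ {t = t} =
  ∀-elim t (⊢⇒⊩ (closed (induction (`0 `+ v₀ ≐ v₀) +-identityʳ (≐-trans +-sucʳ (S-cong #0)))))

+-sucˡ : (s u : Tm n) → Γ ⊩ (`S s `+ u ≐ `S (s `+ u))
+-sucˡ s u =
  cast (cong (λ a → `S a `+ u ≐ `S (a `+ u)) (wkTm-[] s u)) (∀-elim u (∀-elim s (⊢⇒⊩ +-sucˡ-∀)))
  where
  +-sucˡ-∀ : PAK4⊢_ {n} (∀' (∀' (`S v₁ `+ v₀ ≐ `S (v₁ `+ v₀))))
  +-sucˡ-∀ = closed (∀-intro (induction _ (≐-trans +-identityʳ (S-cong (≐-sym +-identityʳ)))
                                          (≐-trans +-sucʳ (≐-trans (S-cong #0) (S-cong (≐-sym +-sucʳ))))))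

≼-elim : Γ ⊩ (s ≼ t) → Γ ⊩ ∃' (wkTm s `+ v₀ ≐ wkTm t)
≼-elim {s = s} {t = t} = app (∧-elim₁ (⊢⇒⊩ (pa (q7 s t))))

≼-intro : (u : Tm n) → Γ ⊩ (s `+ u ≐ t) → Γ ⊩ (s ≼ t)
≼-intro {s = s} {t = t} u p =
  app (∧-elim₂ (⊢⇒⊩ (pa (q7 s t))))
    (∃-intro u (cast (cong₂ (λ a b → a `+ u ≐ b) (sym (wkTm-[] s u)) (sym (wkTm-[] t u))) p))

S≰0 : Γ ⊩ (`S s ≼ `0) → Γ ⊩ φ
S≰0 p = ∃-elim (≼-elim p) (S≢0 (≐-trans (≐-sym (+-sucˡ _ _)) #0))

S-mono-≼ : Γ ⊩ (s ≼ t) → Γ ⊩ (`S s ≼ `S t)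
S-mono-≼ p = ∃-elim (≼-elim p) (≼-intro v₀ (≐-trans (+-sucˡ _ _) (S-cong #0)))

S-cancel-≼ : Γ ⊩ (`S s ≼ `S t) → Γ ⊩ (s ≼ t)
S-cancel-≼ p = ∃-elim (≼-elim p) (≼-intro v₀ (S-injective (≐-trans (≐-sym (+-sucˡ _ _)) #0)))

<-sucʳ : Γ ⊩ (s ≺ t) → Γ ⊩ (s ≺ `S t)
<-sucʳ p = ∃-elim (≼-elim p) (≼-intro (`S v₀) (≐-trans +-sucʳ (S-cong #0)))

<-suc : Γ ⊩ (s ≺ `S s)
<-suc = ≼-intro `0 +-identityʳ

<-suc-split : Γ ⊩ (s ≺ `S t) → Γ ⊩ ((s ≺ t) ∨' (s ≐ t))
<-suc-split p = ∃-elim (≼-elim p) (∨-elim (zero-or-suc v₀)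
  (∨-intro₂ (S-injective (≐-trans (≐-sym (≐-trans (+-congˡ _ #0) +-identityʳ)) #1)))
  (∃-elim #0 (∨-intro₁ (≼-intro v₀
    (S-injective (≐-trans (≐-sym +-sucʳ) (≐-trans (≐-sym (+-congˡ _ #0)) #2)))))))

≼-□ : Γ ⊩ (s ≼ t) → Γ ⊩ □ (s ≼ t)
≼-□ p = ∃-elim (≼-elim p) (□-map (≼-intro v₀ ⇒-refl) (≐-□ #0))

-- Induction on x, splitting y into 0 or a successor.

≐-or-□≢ : (s t : Tm n) → Γ ⊩ (s ≐ t ∨' □ (¬' (s ≐ t)))
≐-or-□≢ s t =
  cast (cong (λ a → a ≐ t ∨' □ (¬' (a ≐ t))) (wkTm-[] s t)) (∀-elim t (∀-elim s (⊢⇒⊩ ≐-or-□≢-∀)))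
  where
  ≐-or-□≢-∀ : PAK4⊢_ {n} (∀' (∀' (v₁ ≐ v₀ ∨' □ (¬' (v₁ ≐ v₀)))))
  ≐-or-□≢-∀ = closed (induction (∀' (v₁ ≐ v₀ ∨' □ (¬' (v₁ ≐ v₀))))
    (∀-intro (∨-elim (zero-or-suc v₀)
      (∨-intro₁ (≐-sym #0))
      (∃-elim #0 (∨-intro₂ (≐-subst (□ (¬' (`0 ≐ v₀))) (≐-sym #0) (□-intro (S≢0 (≐-sym ⇒-refl))))))))
    (∀-intro (∨-elim (zero-or-suc v₀)
      (∨-intro₂ (≐-subst (□ (¬' (`S v₂ ≐ v₀))) (≐-sym #0) (□-intro (S≢0 ⇒-refl))))
      (∃-elim #0 (∨-elim (∀-elim v₀ #2)
        (∨-intro₁ (≐-trans (S-cong #0) (≐-sym #1)))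
        (∨-intro₂ (≐-subst (□ (¬' (`S v₃ ≐ v₀))) (≐-sym #1)
          (□-map (lam (app (weaken ⇒-refl) (S-injective #0))) #0))))))))

≼-or-□≰ : (s t : Tm n) → Γ ⊩ (s ≼ t ∨' □ (¬' (s ≼ t)))
≼-or-□≰ s t =
  cast (cong (λ a → a ≼ t ∨' □ (¬' (a ≼ t))) (wkTm-[] s t)) (∀-elim t (∀-elim s (⊢⇒⊩ ≼-or-□≰-∀)))
  where
  ≼-or-□≰-∀ : PAK4⊢_ {n} (∀' (∀' (v₁ ≼ v₀ ∨' □ (¬' (v₁ ≼ v₀)))))
  ≼-or-□≰-∀ = closed (induction (∀' (v₁ ≼ v₀ ∨' □ (¬' (v₁ ≼ v₀))))
    (∀-intro (∨-intro₁ (≼-intro v₀ +-identityˡ)))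
    (∀-intro (∨-elim (zero-or-suc v₀)
      (∨-intro₂ (≐-subst (□ (¬' (`S v₂ ≼ v₀))) (≐-sym #0) (□-intro (S≰0 ⇒-refl))))
      (∃-elim #0 (∨-elim (∀-elim v₀ #2)
        (∨-intro₁ (≐-subst (`S v₃ ≼ v₀) (≐-sym #1) (S-mono-≼ #0)))
        (∨-intro₂ (≐-subst (□ (¬' (`S v₃ ≼ v₀))) (≐-sym #1)
          (□-map (lam (app (weaken ⇒-refl) (S-cancel-≼ #0))) #0))))))))

Complete : Fm n → Set
Complete φ = PAK4⊢ (φ ⇒ □ φ)

Decided : Fm n → Set
Decided φ = Complete φ × Complete (¬' φ)

□-complete : (φ : Fm n) → Complete (□ φ)
□-complete φ = ax4 (four φ)

∧-complete : Complete A → Complete B → Complete (A ∧' B)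
∧-complete a b = □-map₂ (log (ax-∧i _ _)) (app⊢ a (∧-elim₁ ⇒-refl)) (app⊢ b (∧-elim₂ ⇒-refl))

∨-complete : Complete A → Complete B → Complete (A ∨' B)
∨-complete a b =
  ∨-elim ⇒-refl (□-map (log (ax-∨i₁ _ _)) (app⊢ a #0)) (□-map (log (ax-∨i₂ _ _)) (app⊢ b #0))

∃-complete : Complete φ → Complete (∃' φ)
∃-complete c = ∃-elim ⇒-refl (□-map (∃-intro-wk₁ ⇒-refl) (app⊢ c #0))

∀<-complete : (t : Tm n) → Complete φ → Complete (∀<' t φ)
∀<-complete {n = n} {φ = ψ} t c =
  closed (cast (cong (λ X → ∀<' t X ⇒ □ (∀<' t X)) (sub-ren-id e-inst ψ))
    (∀-elim t (⊢⇒⊩ (closed (induction (below ⇒ □ below) base (cast step-eq step))))))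
  where
  below below-S : Fm (suc n)
  below  = ∀<' v₀ (wk₁ ψ)
  below-S = ∀<' (`S v₀) (wk₁ ψ)

  e-inst : liftSub (inst t) ∘ liftRen suc ≗ var
  e-inst zero    = refl
  e-inst (suc i) = refl

  e-succ : liftSub succVar ∘ liftRen suc ≗ var ∘ liftRen suc
  e-succ zero    = refl
  e-succ (suc i) = refl

  step-eq : (below-S ⇒ □ below-S) ≡ sub succVar (below ⇒ □ below)
  step-eq = cong (λ X → ∀<' (`S v₀) X ⇒ □ (∀<' (`S v₀) X)) (sym (sub-ren-var e-succ ψ))

  -- the case x = y of x < S y rewrites ψ(y) to ψ(x) along the motive ren wk²₁ ψ = ψ(z)
  wk²₁ : Fin (suc n) → Fin (suc (suc (suc n)))
  wk²₁ = liftRen (λ i → suc (suc i))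

  e-y : inst v₁ ∘ wk²₁ ≗ var ∘ suc
  e-y zero    = refl
  e-y (suc i) = refl

  e-x : inst v₀ ∘ wk²₁ ≗ var ∘ liftRen suc
  e-x zero    = refl
  e-x (suc i) = refl

  extend : PAK4⊢ (below ⇒ ψ ⇒ below-S)
  extend = lam (∀-intro (lam (∨-elim (<-suc-split #0)
    (app (∀-elim-wk₁ ((v₀ ≺ v₁) ⇒ wk₁ ψ) (weaken (weaken (weaken ⇒-refl)))) #0)
    (cast (sub-ren-var e-x ψ) (≐-subst (ren wk²₁ ψ) (≐-sym #0)
      (cast (sym (sub-ren-var e-y ψ)) #2))))))

  base : ⊤' ⊩ (below ⇒ □ below) [ `0 ]
  base = lam (□-intro (closed (∀-intro (lam (S≰0 #0)))))

  step : ⊤' ∧' (below ⇒ □ below) ⊩ (below-S ⇒ □ below-S)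
  step = lam (□-map₂ extend
    (app #1 (∀-intro (lam (app (∀-elim-wk₁ ((v₀ ≺ `S v₁) ⇒ wk₁ ψ) #1) (<-sucʳ #0)))))
    (app⊢ c (app (cast (cong ((v₀ ≺ `S v₀) ⇒_) (wk₁-[v₀] ψ)) (∀-elim v₀ #0)) <-suc)))

⊥-decided : Decided {n} ⊥'
⊥-decided = ⊥'-elim ⇒-refl , □-intro ⇒-refl

≐-decided : (s t : Tm n) → Decided (s ≐ t)
≐-decided s t = ≐-□ ⇒-refl , ∨-elim (≐-or-□≢ s t) (⊥'-elim (app (weaken ⇒-refl) #0)) #0

≼-decided : (s t : Tm n) → Decided (s ≼ t)
≼-decided s t = ≼-□ ⇒-refl , ∨-elim (≼-or-□≰ s t) (⊥'-elim (app (weaken ⇒-refl) #0)) #0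

⇒-decided : Decided A → Decided B → Decided (A ⇒ B)
⇒-decided {A = A} {B = B} (a , ¬a) (b , ¬b) =
  cases (□-map (log (ax-k B A)) (app⊢ b (app (weaken ⇒-refl) #0)))
        (□-map (lam (⊥'-elim (app (weaken ⇒-refl) #0))) (app⊢ ¬a #0)) ,
  □-map₂ (lam (lam (app #1 (app #0 (weaken (weaken ⇒-refl))))))
         (app⊢ a (by-contradiction (app (weaken ⇒-refl) (lam (⊥'-elim (app #1 #0))))))
         (app⊢ ¬b (lam (app (weaken ⇒-refl) (lam #1))))

∧-decided : Decided A → Decided B → Decided (A ∧' B)
∧-decided (a , ¬a) (b , ¬b) =
  ∧-complete a b ,
  cases (□-map (lam (app (weaken ⇒-refl) (∧-elim₂ #0)))
               (app⊢ ¬b (lam (app (weaken (weaken ⇒-refl)) (∧-intro #1 #0)))))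
        (□-map (lam (app (weaken ⇒-refl) (∧-elim₁ #0))) (app⊢ ¬a #0))

∨-decided : Decided A → Decided B → Decided (A ∨' B)
∨-decided (a , ¬a) (b , ¬b) =
  ∨-complete a b ,
  □-map₂ (lam (lam (∨-elim #0 (app (weaken (weaken (weaken ⇒-refl))) #0) (app #2 #0))))
         (app⊢ ¬a (lam (app (weaken ⇒-refl) (∨-intro₁ #0))))
         (app⊢ ¬b (lam (app (weaken ⇒-refl) (∨-intro₂ #0))))

-- A counterexample x < t to φ is itself complete: both x < t and ¬φ(x) are.
∀<-decided : (t : Tm n) → Decided φ → Decided (∀<' t φ)
∀<-decided {φ = φ} t (c , ¬c) =
  ∀<-complete t c ,
  ∃-elim counterexample (□-map₂ refutes (≼-□ (∧-elim₁ #0)) (app⊢ ¬c (∧-elim₂ #0)))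
  where
  counterexample : ¬' (∀<' t φ) ⊩ ∃' ((v₀ ≺ wkTm t) ∧' ¬' φ)
  counterexample = by-contradiction (app (weaken ⇒-refl) (∀-intro (lam (by-contradiction
    (app #2 (∃-intro-wk₁ (∧-intro #1 #0)))))))

  refutes : PAK4⊢ ((v₀ ≺ wkTm t) ⇒ ¬' φ ⇒ ¬' (wk (∀<' t φ)))
  refutes = lam (lam (app #1 (app (∀-elim-wk₁ ((v₀ ≺ wkTm t) ⇒ φ) #0) (weaken (weaken ⇒-refl)))))

∃<-decided : (t : Tm n) → Decided φ → Decided (∃<' t φ)
∃<-decided {φ = φ} t (c , ¬c) =
  ∃-complete (∧-complete (≼-□ ⇒-refl) c) ,
  □-map none-below (app⊢ (∀<-complete t ¬c) all-refuted)
  where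
  all-refuted : ¬' (∃<' t φ) ⊩ ∀<' t (¬' φ)
  all-refuted = ∀-intro (lam (lam (app (weaken (weaken ⇒-refl)) (∃-intro-wk₁ (∧-intro #1 #0)))))

  none-below : PAK4⊢ (∀<' t (¬' φ) ⇒ ¬' (∃<' t φ))
  none-below = lam (∃-elim #0 (app (app (∀-elim-wk₁ ((v₀ ≺ wkTm t) ⇒ ¬' φ) (weaken (weaken ⇒-refl)))
                                        (∧-elim₁ #0))
                                   (∧-elim₂ #0)))

Δ₀-decided : Δ₀ φ → Decided φ
Δ₀-decided (eq s t)   = ≐-decided s t
Δ₀-decided (le s t)   = ≼-decided s t
Δ₀-decided bot        = ⊥-decided
Δ₀-decided (imp d e)  = ⇒-decided (Δ₀-decided d) (Δ₀-decided e)
Δ₀-decided (and d e)  = ∧-decided (Δ₀-decided d) (Δ₀-decided e)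
Δ₀-decided (or d e)   = ∨-decided (Δ₀-decided d) (Δ₀-decided e)
Δ₀-decided (ball t d) = ∀<-decided t (Δ₀-decided d)
Δ₀-decided (bex t d)  = ∃<-decided t (Δ₀-decided d)

Σ₁-complete : Σ₁ φ → Complete φ
Σ₁-complete (δ d)  = proj₁ (Δ₀-decided d)
Σ₁-complete (ex s) = ∃-complete (Σ₁-complete s)

theorem3p5 : ∀ {n : ℕ} (φ : Fm n) → Σ₁□ φ → PAK4⊢ (φ ⇒ □ φ)
theorem3p5 φ (sigma s)   = Σ₁-complete s
theorem3p5 _ (box φ)     = □-complete φ
theorem3p5 _ (and a b)   = ∧-complete (theorem3p5 _ a) (theorem3p5 _ b)
theorem3p5 _ (or a b)    = ∨-complete (theorem3p5 _ a) (theorem3p5 _ b)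
theorem3p5 _ (ex a)      = ∃-complete (theorem3p5 _ a)
theorem3p5 _ (ball t a)  = ∀<-complete t (theorem3p5 _ a)
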